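{- Let $i\in\{0,1,2,3\}$, $t\in\mathbb{N}$ and $k,\ell\in[h]$ with $|k-\ell|=1$, and assume $\Delta r_i^\ell(t)=1$ and $r_i^k(t-1)=r_i^\ell(t-1)+1$. Then $\varphi_i^\ell(t)+\Delta f_i^\ell(t)\ge\varphi_i^k(t-1)-2$.
   Context: Setting: $q\in\{1,2\}$, $h\in\mathbb{N}$, $[h]=\{1,\dots,h\}$, graph $G_1=(\mathbb{Z}\,\Box\,\mathbb{Z})\,\Box\,[h]$ or $G_2=(\mathbb{Z}\boxtimes\mathbb{Z})\,\Box\,[h]$ on vertex set $\mathbb{Z}^2\times[h]$ (in $G_1$: 4 horizontal nearest neighbours plus up/down; in $G_2$: 8 horizontal king-move neighbours plus up/down). Direction indices are taken mod 4. For $G_1$: $\theta_0=(\tfrac12,\tfrac12,0),\theta_1=(\tfrac12,-\tfrac12,0),\theta_2=(-\tfrac12,-\tfrac12,0),\theta_3=(-\tfrac12,\tfrac12,0)$; for $G_2$: $\theta_0=(0,1,0),\theta_1=(1,0,0),\theta_2=(0,-1,0),\theta_3=(-1,0,0)$; $\phi=(0,0,1)$. $L^k_{i,d}(a,b)=\{d\theta_i+m\theta_{i+1}+k\phi: m\in\mathbb{R},\,-a\le m<b\}\cap\mathbb{Z}^3$. Fire process: a finite initial burning set $B(0)$ and a non-decreasing sequence $(\mathsf F(t))_{t\in\mathbb{N}}$ of finite protected-vertex sets; $B(t)=B(t-1)\cup(B(t-1)^+\setminus\mathsf F(t))$, with $U^+$ the closed neighbourhood of $U$ in $G_q$. Fronts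 structure: a vector $\vec x\in\mathbb{N}^h$ is Lipschitz if $|x^{k+1}-x^k|\le1$ for all $k$; $\operatorname{lip}(\vec x)$ is the minimal Lipschitz vector dominating $\vec x$ coordinatewise. Lipschitz vectors $\vec\rho_i(t)=(r_i^1(t),\dots,r_i^h(t))$, $i\in\{0,1,2,3\}$, with $\vec\rho_i(0)$ having all entries $\ge1$ and $\vec\rho_i(t)=\operatorname{lip}(\vec\rho_i(t-1)+\vec\alpha_i(t))$, where $\vec\alpha_i(t)=(a_i^1(t),\dots,a_i^h(t))\in\{0,1\}^h$ depends only on the history up to time $t-1$ and satisfies $a_i^k(t)=0$ whenever $\varphi_i^k(t-1)=0$ and $a_i^k(t)=1$ whenever $\varphi_i^k(t-1)>4qh^4-2$. Levels: $L_i^k(t)=L^k_{i,r_i^k(t)}\big(r^k_{i-1}(t),r^k_{i+1}(t)\big)$. Fierity: $\varphi_i^k(t)=|L_i^k(t)\cap B(t)|$. Counted protected vertices: $F_i^k(0)=\varnothing$, $F^k(t)=\bigcup_{j}F_j^k(t)$, $\Delta F_i^k(t)=\big((\mathsf F(t)\cap L_i^k(t))\setminus B(t)\big)\setminus F^k(t-1)$, $F_i^k(t)=F_i^k(t-1)\sqcup\Delta F_i^k(t)$, and $\Delta f_i^k(t)=|\Delta F_i^k(t)|$. Also $\Delta r_i^\ell(t)=r_i^\ell(t)-r_i^\ell(t-1)$. -}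

module Defs where

open import Data.Bool using (Bool; true; false; _∧_; _∨_; not; if_then_else_)
open import Data.Nat as ℕ using (ℕ; zero; suc; _≤_; _<_; _≡ᵇ_; _*_; _∸_; _^_)
open import Data.Integer as ℤ using (ℤ; +_; _/ℕ_; _%ℕ_)
import Data.Integer.Properties as ℤP
open import Data.Fin as Fin using (Fin; toℕ)
import Data.Fin.Properties as FinP
open import Data.Product using (_×_; _,_)
open import Data.Product.Properties using (≡-dec)
open import Data.List using (List; []; _∷_; [_]; map; concatMap; upTo; allFin; filterᵇ; length)
open import Data.Bool.ListAction using (any)
open import Data.List.Membership.Propositional using (_∈_)
open import Relation.Nullary.Decidable using (⌊_⌋)
open import Relation.Binary.PropositionalEquality using (_≡_)
open import Relation.Binary.Definitions using (DecidableEquality)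

-- The two graphs  G₁ = (ℤ □ ℤ) □ [h]   and   G₂ = (ℤ ⊠ ℤ) □ [h]

data Q : Set where
  G₁ G₂ : Q

qval : Q → ℕ
qval G₁ = 1
qval G₂ = 2

-- Vertices of ℤ² × [h]; the height k ∈ [h] = {1,…,h} is encoded as Fin h
-- (toℕ k = k - 1).
Pt : ℕ → Set
Pt h = ℤ × ℤ × Fin h

_≟Pt_ : ∀ {h} → DecidableEquality (Pt h)
_≟Pt_ = ≡-dec ℤ._≟_ (≡-dec ℤ._≟_ FinP._≟_)

_∈ᵇ_ : ∀ {h} → Pt h → List (Pt h) → Bool
v ∈ᵇ U = any (λ u → ⌊ u ≟Pt v ⌋) U

hsteps : Q → List (ℤ × ℤ)
hsteps G₁ = (+ 1 , + 0) ∷ (ℤ.- + 1 , + 0) ∷ (+ 0 , + 1) ∷ (+ 0 , ℤ.- + 1) ∷ []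
hsteps G₂ = (+ 1 , + 0) ∷ (ℤ.- + 1 , + 0) ∷ (+ 0 , + 1) ∷ (+ 0 , ℤ.- + 1)
          ∷ (+ 1 , + 1) ∷ (+ 1 , ℤ.- + 1) ∷ (ℤ.- + 1 , + 1) ∷ (ℤ.- + 1 , ℤ.- + 1) ∷ []

vadj : ∀ {h} → Fin h → Fin h → Bool
vadj k k' = (suc (toℕ k) ≡ᵇ toℕ k') ∨ (suc (toℕ k') ≡ᵇ toℕ k)

nbrs : ∀ (q : Q) {h} → Pt h → List (Pt h)
nbrs q {h} (x , y , k) =
  map (λ { (dx , dy) → (x ℤ.+ dx , y ℤ.+ dy , k) }) (hsteps q)
  Data.List.++ map (λ k' → (x , y , k')) (filterᵇ (vadj k) (allFin h))

inB : (q : Q) {h : ℕ} (B0 : List (Pt h)) (F : ℕ → List (Pt h)) → ℕ → Pt h → Bool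
inB q B0 F zero v = v ∈ᵇ B0
inB q B0 F (suc t) v =
  inB q B0 F t v ∨ ((any (inB q B0 F t) (nbrs q v)) ∧ not (v ∈ᵇ F (suc t)))

NonDecreasing : ∀ {h} → (ℕ → List (Pt h)) → Set
NonDecreasing F = ∀ t v → v ∈ F t → v ∈ F (suc t)

next prev : Fin 4 → Fin 4
next Fin.zero = Fin.suc Fin.zero
next (Fin.suc Fin.zero) = Fin.suc (Fin.suc Fin.zero)
next (Fin.suc (Fin.suc Fin.zero)) = Fin.suc (Fin.suc (Fin.suc Fin.zero))
next (Fin.suc (Fin.suc (Fin.suc Fin.zero))) = Fin.zero
prev Fin.zero = Fin.suc (Fin.suc (Fin.suc Fin.zero))
prev (Fin.suc Fin.zero) = Fin.zero
prev (Fin.suc (Fin.suc Fin.zero)) = Fin.suc Fin.zero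
prev (Fin.suc (Fin.suc (Fin.suc Fin.zero))) = Fin.suc (Fin.suc Fin.zero)

-- scale q · θ_i  (horizontal part), with scale 2 for G₁ and 1 for G₂,
-- so that these are integer vectors
scale : Q → ℕ
scale G₁ = 2
scale G₂ = 1

sθ : Q → Fin 4 → ℤ × ℤ
sθ G₁ Fin.zero = (+ 1 , + 1)
sθ G₁ (Fin.suc Fin.zero) = (+ 1 , ℤ.- + 1)
sθ G₁ (Fin.suc (Fin.suc Fin.zero)) = (ℤ.- + 1 , ℤ.- + 1)
sθ G₁ (Fin.suc (Fin.suc (Fin.suc Fin.zero))) = (ℤ.- + 1 , + 1)
sθ G₂ Fin.zero = (+ 0 , + 1)
sθ G₂ (Fin.suc Fin.zero) = (+ 1 , + 0)
sθ G₂ (Fin.suc (Fin.suc Fin.zero)) = (+ 0 , ℤ.- + 1)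
sθ G₂ (Fin.suc (Fin.suc (Fin.suc Fin.zero))) = (ℤ.- + 1 , + 0)

halfPt : (q : Q) {h : ℕ} → ℤ × ℤ → Fin h → List (Pt h)
halfPt G₁ (X , Y) k =
  if ((X %ℕ 2) ≡ᵇ 0) ∧ ((Y %ℕ 2) ≡ᵇ 0) then [ (X /ℕ 2 , Y /ℕ 2 , k) ] else []
halfPt G₂ (X , Y) k = [ (X , Y , k) ]

-- L^k_{i,d}(a,b) = {dθ_i + mθ_{i+1} + kφ : m ∈ ℝ, -a ≤ m < b} ∩ ℤ³,
-- listed (without repetition) by the parameter m, which is necessarily an
-- integer for a lattice point; m runs over -a, …, b-1.
levelPts : (q : Q) {h : ℕ} → Fin 4 → (d a b : ℕ) → Fin h → List (Pt h)
levelPts q i d a b k = concatMap pt (upTo (a ℕ.+ b))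
  where
  pt : ℕ → List _
  pt j with sθ q i | sθ q (next i)
  ... | (ux , uy) | (wx , wy) =
    let m = + j ℤ.- + a in
    halfPt q (+ d ℤ.* ux ℤ.+ m ℤ.* wx , + d ℤ.* uy ℤ.+ m ℤ.* wy) k

Lipschitz : ∀ {h} → (Fin h → ℕ) → Set
Lipschitz {h} x = ∀ (k l : Fin h) → suc (toℕ k) ≡ toℕ l →
  (x l ≤ suc (x k)) × (x k ≤ suc (x l))

Dominates : ∀ {h} → (Fin h → ℕ) → (Fin h → ℕ) → Set
Dominates y x = ∀ k → x k ≤ y k

IsLip : ∀ {h} → (x y : Fin h → ℕ) → Set
IsLip x y = Lipschitz y × Dominates y x
  × (∀ z → Lipschitz z → Dominates z x → Dominates z y)

-- Quantities attached to a run (q, h, B0, 𝖥, ρ), where ρ t i k = r_i^k(t)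

module Run (q : Q) (h : ℕ) (B0 : List (Pt h)) (F : ℕ → List (Pt h))
           (ρ : ℕ → Fin 4 → Fin h → ℕ) where

  B : ℕ → Pt h → Bool
  B = inB q B0 F

  L : ℕ → Fin 4 → Fin h → List (Pt h)
  L t i k = levelPts q i (ρ t i k) (ρ t (prev i) k) (ρ t (next i) k) k

  φ : ℕ → Fin 4 → Fin h → ℕ
  φ t i k = length (filterᵇ (B t) (L t i k))

  inFi : ℕ → Fin 4 → Fin h → Pt h → Bool
  inΔF : ℕ → Fin 4 → Fin h → Pt h → Bool   -- inΔF s = ΔF(s+1)
  inFk : ℕ → Fin h → Pt h → Bool

  inFi zero i k v = false
  inFi (suc s) i k v = inFi s i k v ∨ inΔF s i k v
  inΔF s i k v = (v ∈ᵇ F (suc s)) ∧ (v ∈ᵇ L (suc s) i k)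
                 ∧ not (B (suc s) v) ∧ not (inFk s k v)
  inFk s k v = any (λ j → inFi s j k v) (allFin 4)

  -- Δf_i^k(s+1) = |ΔF_i^k(s+1)|  (ΔF_i^k(s+1) ⊆ L_i^k(s+1))
  Δf : ℕ → Fin 4 → Fin h → ℕ   -- Δf s = Δf(s+1)
  Δf s i k = length (filterᵇ (inΔF s i k) (L (suc s) i k))

  -- the fronts-structure axioms, with α t i k = a_i^k(t)
  record IsFronts (α : ℕ → Fin 4 → Fin h → ℕ) : Set where
    field
      init-pos : ∀ i k → 1 ≤ ρ 0 i k
      init-lip : ∀ i → Lipschitz (ρ 0 i)
      α-bin    : ∀ t i k → α t i k ≤ 1
      step     : ∀ t i → IsLip (λ k → ρ t i k ℕ.+ α (suc t) i k) (ρ (suc t) i)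
      α-zero   : ∀ t i k → φ t i k ≡ 0 → α (suc t) i k ≡ 0
      α-one    : ∀ t i k → (4 * qval q * h ^ 4) ∸ 2 < φ t i k → α (suc t) i k ≡ 1

module Submission where

open import Defs
open import Data.Nat using (ℕ; suc; _+_; _≤_)
open import Data.Fin using (Fin; toℕ)
open import Data.List using (List)
open import Data.Sum using (_⊎_)
open import Relation.Binary.PropositionalEquality using (_≡_)

open import Data.Bool using (Bool; true; false; T; T?; not; _∧_; _∨_)
open import Data.Bool.ListAction using (any)
open import Data.Bool.Properties using (T-∧; T-∨; T-≡)
open import Data.Fin.Patterns using (0F; 1F; 2F; 3F)
open import Data.Integer as ℤ using (ℤ; +_; -[1+_]; -1ℤ; _/ℕ_; _%ℕ_)
open import Data.Integer.DivMod using (a≡a%ℕn+[a/ℕn]*n)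
import Data.Integer.Properties as ℤP
open import Data.Integer.Tactic.RingSolver using (solve-∀)
open import Data.List using ([]; _∷_; _++_; [_]; _∷ʳ_; map; concatMap; upTo; applyUpTo; allFin; filterᵇ; length)
open import Data.List.Membership.Propositional using (_∈_; find; lose)
open import Data.List.Membership.Propositional.Properties
  using (∈-filter⁺; ∈-allFin; ∈-++⁺ʳ; ∈-map⁺; ∈-map⁻; ∈-upTo⁻; ∈-concatMap⁺; ∈-concatMap⁻)
open import Data.List.Properties
  using (filter-++; length-++; length-filter; concatMap-map; map-cong; map-upTo; map-applyUpTo; upTo-∷ʳ; map-++)
open import Data.List.Relation.Unary.Any as Any using (here; there; satisfied)
open import Data.List.Relation.Unary.Any.Properties using (any⁺; any⁻)
open import Data.Nat as ℕ using (zero; z≤n; s≤s; _≡ᵇ_; _∸_)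
open import Data.Nat.ListAction using (sum)
open import Data.Nat.ListAction.Properties using (sum-++)
import Data.Nat.Properties as ℕP
open import Algebra.Properties.CommutativeSemigroup ℕP.+-commutativeSemigroup using (interchange)
open import Data.Product using (_×_; _,_; proj₁; proj₂; ∃₂)
open import Data.Sum using (inj₁; inj₂)
open import Function using (_∘_; Equivalence)
open import Relation.Binary.PropositionalEquality
  using (refl; sym; trans; cong; cong₂; subst; subst₂; module ≡-Reasoning)
open import Relation.Nullary using (¬_)
open import Relation.Nullary.Decidable using (toWitness; fromWitness)

-- Both levels are parametrised by the coordinate m along θ_{i+1}. Since r_i^k(t-1) = r_i^ℓ(t),
-- the lines carrying L_i^k(t-1) and L_i^ℓ(t) lie directly above each other, and each parameter
-- carries at most one lattice point. Lipschitzness and monotonicity of the fronts give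
-- r_{i±1}^k(t-1) ≤ r_{i±1}^ℓ(t) + 1, so at most two parameters of L_i^k(t-1) are missing from
-- L_i^ℓ(t). For a shared parameter the point at height ℓ is a neighbour of the one at height k;
-- if the latter burns at time t-1, the former burns at time t or is protected at time t, and in
-- the second case it is newly counted in ΔF_i^ℓ(t): everything counted in F^ℓ(t-1) lies inside
-- the fronts at time t-1, i.e. has θ_i-coordinate at most r_i^ℓ(t-1) < r_i^ℓ(t).

count : ∀ {A : Set} → (A → Bool) → List A → ℕ
count P xs = length (filterᵇ P xs)

count-concatMap : ∀ {A B : Set} (P : B → Bool) (g : A → List B) xs →
  count P (concatMap g xs) ≡ sum (map (count P ∘ g) xs)
count-concatMap P g []       = refl
count-concatMap P g (x ∷ xs) = begin
  length (filterᵇ P (g x ++ concatMap g xs))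
    ≡⟨ cong length (filter-++ (T? ∘ P) (g x) (concatMap g xs)) ⟩
  length (filterᵇ P (g x) ++ filterᵇ P (concatMap g xs))
    ≡⟨ length-++ (filterᵇ P (g x)) ⟩
  count P (g x) + count P (concatMap g xs)
    ≡⟨ cong (count P (g x) ℕ.+_) (count-concatMap P g xs) ⟩
  count P (g x) + sum (map (count P ∘ g) xs)
    ∎
  where open ≡-Reasoning

count-singleton-≤ : ∀ {A : Set} {P Q R : A → Bool} {u v} → (T (P u) → T (Q v) ⊎ T (R v)) →
  count P [ u ] ≤ count Q [ v ] + count R [ v ]
count-singleton-≤ {P = P} {Q} {R} {u} {v} P⇒Q⊎R with P u | Q v | R v | P⇒Q⊎R
... | false | _     | _     | _    = z≤n
... | true  | true  | _     | _    = s≤s z≤n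
... | true  | false | true  | _    = s≤s z≤n
... | true  | false | false | P⇒⊥ with P⇒⊥ _
...   | inj₁ ()
...   | inj₂ ()

sum-map-∷ʳ : ∀ {A : Set} (f : A → ℕ) xs x → sum (map f (xs ∷ʳ x)) ≡ sum (map f xs) + f x
sum-map-∷ʳ f xs x = begin
  sum (map f (xs ∷ʳ x))            ≡⟨ cong sum (map-++ f xs [ x ]) ⟩
  sum (map f xs ++ [ f x ])        ≡⟨ sum-++ (map f xs) [ f x ] ⟩
  sum (map f xs) + (f x + 0)       ≡⟨ cong (sum (map f xs) ℕ.+_) (ℕP.+-identityʳ (f x)) ⟩
  sum (map f xs) + f x             ∎
  where open ≡-Reasoning

sum-map-+ : ∀ {A : Set} (f g : A → ℕ) xs →
  sum (map (λ x → f x + g x) xs) ≡ sum (map f xs) + sum (map g xs)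
sum-map-+ f g []       = refl
sum-map-+ f g (x ∷ xs) = trans (cong (f x + g x ℕ.+_) (sum-map-+ f g xs))
  (interchange (f x) (g x) (sum (map f xs)) (sum (map g xs)))

sum-map-mono-≤ : ∀ {A : Set} {f g : A → ℕ} xs → (∀ {x} → x ∈ xs → f x ≤ g x) →
  sum (map f xs) ≤ sum (map g xs)
sum-map-mono-≤ []       f≤g = z≤n
sum-map-mono-≤ (x ∷ xs) f≤g = ℕP.+-mono-≤ (f≤g (here refl)) (sum-map-mono-≤ xs (f≤g ∘ there))

T-not⁺ : ∀ {b} → ¬ T b → T (not b)
T-not⁺ {true}  ¬b = ¬b _
T-not⁺ {false} _  = _

T-∨-∧-not : ∀ b n f → T n → T (b ∨ n ∧ not f) ⊎ (T f × T (not (b ∨ n ∧ not f)))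
T-∨-∧-not true  n     f     _ = inj₁ _
T-∨-∧-not false true  false _ = inj₁ _
T-∨-∧-not false true  true  _ = inj₂ (_ , _)

∈⇒∈ᵇ : ∀ {h} {v : Pt h} {xs} → v ∈ xs → T (v ∈ᵇ xs)
∈⇒∈ᵇ v∈ = any⁺ _ (Any.map (λ v≡u → fromWitness (sym v≡u)) v∈)

∈ᵇ⇒∈ : ∀ {h} {v : Pt h} {xs} → T (v ∈ᵇ xs) → v ∈ xs
∈ᵇ⇒∈ {xs = xs} v∈ᵇ = Any.map (λ u≟v → sym (toWitness u≟v)) (any⁻ _ xs v∈ᵇ)

window : ℕ → ℕ → List ℤ
window a b = map (λ j → + j ℤ.- + a) (upTo (a + b))

[1+j]-[1+a]≡j-a : ∀ j a → + suc j ℤ.- + suc a ≡ + j ℤ.- + a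
[1+j]-[1+a]≡j-a j a = begin
  + suc j ℤ.- + suc a  ≡⟨ ℤP.m-n≡m⊖n (suc j) (suc a) ⟩
  suc j ℤ.⊖ suc a      ≡⟨ ℤP.[1+m]⊖[1+n]≡m⊖n j a ⟩
  j ℤ.⊖ a              ≡⟨ ℤP.m-n≡m⊖n j a ⟨
  + j ℤ.- + a          ∎
  where open ≡-Reasoning

+[a+b]-a≡b : ∀ a b → + (a + b) ℤ.- + a ≡ + b
+[a+b]-a≡b a b = trans (cong (ℤ._- + a) (ℤP.pos-+ a b)) (cancel (+ a) (+ b))
  where
  cancel : ∀ a b → a ℤ.+ b ℤ.- a ≡ b
  cancel = solve-∀

window-sucˡ : ∀ a b → window (suc a) b ≡ -[1+ a ] ∷ window a b
window-sucˡ a b = cong (-[1+ a ] ∷_) (begin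
  map (offset (suc a)) (applyUpTo suc (a + b))  ≡⟨ map-applyUpTo suc (offset (suc a)) (a + b) ⟩
  applyUpTo (offset (suc a) ∘ suc) (a + b)      ≡⟨ map-upTo (offset (suc a) ∘ suc) (a + b) ⟨
  map (offset (suc a) ∘ suc) (upTo (a + b))     ≡⟨ map-cong (λ j → [1+j]-[1+a]≡j-a j a) (upTo (a + b)) ⟩
  map (offset a) (upTo (a + b))                 ∎)
  where
  open ≡-Reasoning
  offset : ℕ → ℕ → ℤ
  offset a j = + j ℤ.- + a

window-sucʳ : ∀ a b → window a (suc b) ≡ window a b ∷ʳ + b
window-sucʳ a b = begin
  map offset (upTo (a + suc b))           ≡⟨ cong (map offset ∘ upTo) (ℕP.+-suc a b) ⟩
  map offset (upTo (suc (a + b)))         ≡⟨ cong (map offset) (upTo-∷ʳ (a + b)) ⟨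
  map offset (upTo (a + b) ∷ʳ (a + b))    ≡⟨ map-++ offset (upTo (a + b)) [ a + b ] ⟩
  window a b ∷ʳ offset (a + b)            ≡⟨ cong (window a b ∷ʳ_) (+[a+b]-a≡b a b) ⟩
  window a b ∷ʳ + b                       ∎
  where
  open ≡-Reasoning
  offset : ℕ → ℤ
  offset j = + j ℤ.- + a

window-bounds : ∀ {a b m} → m ∈ window a b → ℤ.- + a ℤ.≤ m × m ℤ.< + b
window-bounds {a} {b} m∈ with j , j∈ , refl ← ∈-map⁻ _ m∈ =
  ℤP.i≤j⇒i≤k+j (+ j) ℤP.≤-refl ,
  ℤP.<-≤-trans (ℤP.+-monoˡ-< (ℤ.- + a) (ℤ.+<+ (∈-upTo⁻ j∈))) (ℤP.≤-reflexive (+[a+b]-a≡b a b))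

module _ (f : ℤ → ℕ) where

  sum-window-monoˡ : ∀ c a b → sum (map f (window a b)) ≤ sum (map f (window (c + a) b))
  sum-window-monoˡ zero    a b = ℕP.≤-refl
  sum-window-monoˡ (suc c) a b = begin
    sum (map f (window a b))                                  ≤⟨ sum-window-monoˡ c a b ⟩
    sum (map f (window (c + a) b))                            ≤⟨ ℕP.m≤n+m _ _ ⟩
    f -[1+ c + a ] + sum (map f (window (c + a) b))           ≡⟨ cong (sum ∘ map f) (window-sucˡ (c + a) b) ⟨
    sum (map f (window (suc c + a) b))                        ∎
    where open ℕP.≤-Reasoning

  sum-window-monoʳ : ∀ c a b → sum (map f (window a b)) ≤ sum (map f (window a (c + b)))
  sum-window-monoʳ zero    a b = ℕP.≤-refl
  sum-window-monoʳ (suc c) a b = begin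
    sum (map f (window a b))                                  ≤⟨ sum-window-monoʳ c a b ⟩
    sum (map f (window a (c + b)))                            ≤⟨ ℕP.m≤m+n _ _ ⟩
    sum (map f (window a (c + b))) + f (+ (c + b))            ≡⟨ sum-map-∷ʳ f (window a (c + b)) (+ (c + b)) ⟨
    sum (map f (window a (c + b) ∷ʳ + (c + b)))               ≡⟨ cong (sum ∘ map f) (window-sucʳ a (c + b)) ⟨
    sum (map f (window a (suc c + b)))                        ∎
    where open ℕP.≤-Reasoning

  sum-window-mono : ∀ {a a′ b b′} → a ≤ a′ → b ≤ b′ →
    sum (map f (window a b)) ≤ sum (map f (window a′ b′))
  sum-window-mono {a} {a′} {b} {b′} a≤a′ b≤b′ = begin
    sum (map f (window a b))                          ≤⟨ sum-window-monoˡ (a′ ∸ a) a b ⟩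
    sum (map f (window (a′ ∸ a + a) b))               ≤⟨ sum-window-monoʳ (b′ ∸ b) (a′ ∸ a + a) b ⟩
    sum (map f (window (a′ ∸ a + a) (b′ ∸ b + b)))
      ≡⟨ cong₂ (λ a b → sum (map f (window a b))) (ℕP.m∸n+n≡m a≤a′) (ℕP.m∸n+n≡m b≤b′) ⟩
    sum (map f (window a′ b′))                        ∎
    where open ℕP.≤-Reasoning

  sum-window-≤ : ∀ (g : ℤ → ℕ) {a b a′ b′} → (∀ m → f m ≤ 1) →
    (∀ {m} → m ∈ window a′ b′ → f m ≤ g m) → a ≤ suc a′ → b ≤ suc b′ →
    sum (map f (window a b)) ≤ sum (map g (window a′ b′)) + 2
  sum-window-≤ g {a} {b} {a′} {b′} f≤1 f≤g a≤ b≤ = begin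
    sum (map f (window a b))
      ≤⟨ sum-window-mono a≤ b≤ ⟩
    sum (map f (window (suc a′) (suc b′)))
      ≡⟨ cong (sum ∘ map f) (window-sucˡ a′ (suc b′)) ⟩
    f -[1+ a′ ] + sum (map f (window a′ (suc b′)))
      ≡⟨ cong (λ w → f -[1+ a′ ] + sum (map f w)) (window-sucʳ a′ b′) ⟩
    f -[1+ a′ ] + sum (map f (window a′ b′ ∷ʳ + b′))
      ≡⟨ cong (f -[1+ a′ ] ℕ.+_) (sum-map-∷ʳ f (window a′ b′) (+ b′)) ⟩
    f -[1+ a′ ] + (sum (map f (window a′ b′)) + f (+ b′))
      ≤⟨ ℕP.+-mono-≤ (f≤1 _) (ℕP.+-mono-≤ (sum-map-mono-≤ (window a′ b′) f≤g) (f≤1 _)) ⟩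
    1 + (sum (map g (window a′ b′)) + 1)
      ≡⟨ ℕP.+-suc (sum (map g (window a′ b′))) 1 ⟨
    sum (map g (window a′ b′)) + 2
      ∎
    where open ℕP.≤-Reasoning

_·_ : ℤ × ℤ → ℤ × ℤ → ℤ
(a , b) · (c , d) = a ℤ.* c ℤ.+ b ℤ.* d

-- sθ q i = scale q · θ_i and |θ_i|² = 1 / scale q, so a point dθ_i + mθ_{i+1} has coord q i equal to d.
coord : (q : Q) {h : ℕ} → Fin 4 → Pt h → ℤ
coord q i (x , y , _) = sθ q i · (x , y)

-- θ_i · θ_j / |θ_i|², the same for both graphs.
cosθ : Fin 4 → Fin 4 → ℤ
cosθ i j = sθ G₂ i · sθ G₂ j

sθ·sθ : ∀ q i j → sθ q i · sθ q j ≡ + scale q ℤ.* cosθ i j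
sθ·sθ G₂ i j = sym (ℤP.*-identityˡ _)
sθ·sθ G₁ 0F 0F = refl
sθ·sθ G₁ 0F 1F = refl
sθ·sθ G₁ 0F 2F = refl
sθ·sθ G₁ 0F 3F = refl
sθ·sθ G₁ 1F 0F = refl
sθ·sθ G₁ 1F 1F = refl
sθ·sθ G₁ 1F 2F = refl
sθ·sθ G₁ 1F 3F = refl
sθ·sθ G₁ 2F 0F = refl
sθ·sθ G₁ 2F 1F = refl
sθ·sθ G₁ 2F 2F = refl
sθ·sθ G₁ 2F 3F = refl
sθ·sθ G₁ 3F 0F = refl
sθ·sθ G₁ 3F 1F = refl
sθ·sθ G₁ 3F 2F = refl
sθ·sθ G₁ 3F 3F = refl

cosθ-self : ∀ i → cosθ i i ≡ + 1
cosθ-self 0F = refl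
cosθ-self 1F = refl
cosθ-self 2F = refl
cosθ-self 3F = refl

cosθ-next : ∀ i → cosθ i (next i) ≡ + 0
cosθ-next 0F = refl
cosθ-next 1F = refl
cosθ-next 2F = refl
cosθ-next 3F = refl

-- scale q · (dθ_i + mθ_{i+1}); sidePt lists the lattice point dθ_i + mθ_{i+1} + kφ, if it is integral.
sideVec : Q → Fin 4 → ℕ → ℤ → ℤ × ℤ
sideVec q i d m =
  ( + d ℤ.* proj₁ (sθ q i) ℤ.+ m ℤ.* proj₁ (sθ q (next i))
  , + d ℤ.* proj₂ (sθ q i) ℤ.+ m ℤ.* proj₂ (sθ q (next i)) )

sidePt : (q : Q) {h : ℕ} → Fin 4 → ℕ → ℤ → Fin h → List (Pt h)
sidePt q i d m k = halfPt q (sideVec q i d m) k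

levelPts-sidePt : ∀ q {h} i d a b (k : Fin h) →
  levelPts q i d a b k ≡ concatMap (λ j → sidePt q i d (+ j ℤ.- + a) k) (upTo (a + b))
levelPts-sidePt G₁ 0F d a b k = refl
levelPts-sidePt G₁ 1F d a b k = refl
levelPts-sidePt G₁ 2F d a b k = refl
levelPts-sidePt G₁ 3F d a b k = refl
levelPts-sidePt G₂ 0F d a b k = refl
levelPts-sidePt G₂ 1F d a b k = refl
levelPts-sidePt G₂ 2F d a b k = refl
levelPts-sidePt G₂ 3F d a b k = refl

levelPts-window : ∀ q {h} i d a b (k : Fin h) →
  levelPts q i d a b k ≡ concatMap (λ m → sidePt q i d m k) (window a b)
levelPts-window q i d a b k =
  trans (levelPts-sidePt q i d a b k) (sym (concatMap-map _ _ (upTo (a + b))))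

·-bilinear : ∀ p u w (d m : ℤ) →
  p · (d ℤ.* proj₁ u ℤ.+ m ℤ.* proj₁ w , d ℤ.* proj₂ u ℤ.+ m ℤ.* proj₂ w)
    ≡ d ℤ.* (p · u) ℤ.+ m ℤ.* (p · w)
·-bilinear (px , py) (ux , uy) (wx , wy) = expand px py ux uy wx wy
  where
  expand : ∀ px py ux uy wx wy d m →
    px ℤ.* (d ℤ.* ux ℤ.+ m ℤ.* wx) ℤ.+ py ℤ.* (d ℤ.* uy ℤ.+ m ℤ.* wy)
      ≡ d ℤ.* (px ℤ.* ux ℤ.+ py ℤ.* uy) ℤ.+ m ℤ.* (px ℤ.* wx ℤ.+ py ℤ.* wy)
  expand = solve-∀

even-half : ∀ X → T (X %ℕ 2 ≡ᵇ 0) → X ≡ X /ℕ 2 ℤ.* + 2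
even-half X even = begin
  X                              ≡⟨ a≡a%ℕn+[a/ℕn]*n X 2 ⟩
  + (X %ℕ 2) ℤ.+ X /ℕ 2 ℤ.* + 2  ≡⟨ cong (λ r → + r ℤ.+ X /ℕ 2 ℤ.* + 2) (ℕP.≡ᵇ⇒≡ _ 0 even) ⟩
  + 0 ℤ.+ X /ℕ 2 ℤ.* + 2         ≡⟨ ℤP.+-identityˡ _ ⟩
  X /ℕ 2 ℤ.* + 2                 ∎
  where open ≡-Reasoning

scale-coord-halfPt : ∀ q {h} i P (k : Fin h) {u} → u ∈ halfPt q P k →
  + scale q ℤ.* coord q i u ≡ sθ q i · P
scale-coord-halfPt G₂ i P k (here refl) = ℤP.*-identityˡ _
scale-coord-halfPt G₁ i (X , Y) k u∈
  with (X %ℕ 2 ≡ᵇ 0) ∧ (Y %ℕ 2 ≡ᵇ 0) in even | u∈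
... | true | here refl
  with evenX , evenY ← Equivalence.to T-∧ (Equivalence.from T-≡ even) =
  trans (double (proj₁ (sθ G₁ i)) (proj₂ (sθ G₁ i)) (X /ℕ 2) (Y /ℕ 2))
        (sym (cong₂ (λ x y → sθ G₁ i · (x , y)) (even-half X evenX) (even-half Y evenY)))
  where
  double : ∀ px py x y → + 2 ℤ.* (px ℤ.* x ℤ.+ py ℤ.* y) ≡ px ℤ.* (x ℤ.* + 2) ℤ.+ py ℤ.* (y ℤ.* + 2)
  double = solve-∀

length-halfPt-≤1 : ∀ q {h} P (k : Fin h) → length (halfPt q P k) ≤ 1
length-halfPt-≤1 G₂ P k = s≤s z≤n
length-halfPt-≤1 G₁ (X , Y) k with (X %ℕ 2 ≡ᵇ 0) ∧ (Y %ℕ 2 ≡ᵇ 0)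
... | true  = s≤s z≤n
... | false = z≤n

count-halfPt-≤1 : ∀ {h} (P : Pt h → Bool) q X (k : Fin h) → count P (halfPt q X k) ≤ 1
count-halfPt-≤1 P q X k = ℕP.≤-trans (length-filter (T? ∘ P) (halfPt q X k)) (length-halfPt-≤1 q X k)

halfPt-shape : ∀ q {h} P →
  (∀ (k : Fin h) → halfPt q P k ≡ []) ⊎ ∃₂ λ x y → ∀ (k : Fin h) → halfPt q P k ≡ [ (x , y , k) ]
halfPt-shape G₂ (X , Y) = inj₂ (X , Y , λ _ → refl)
halfPt-shape G₁ (X , Y) with (X %ℕ 2 ≡ᵇ 0) ∧ (Y %ℕ 2 ≡ᵇ 0)
... | true  = inj₂ (X /ℕ 2 , Y /ℕ 2 , λ _ → refl)
... | false = inj₁ (λ _ → refl)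

nonZero-scale : ∀ q → ℤ.NonZero (+ scale q)
nonZero-scale G₁ = _
nonZero-scale G₂ = _

coord-sidePt : ∀ q {h} i j d m (k : Fin h) {u} → u ∈ sidePt q j d m k →
  coord q i u ≡ + d ℤ.* cosθ i j ℤ.+ m ℤ.* cosθ i (next j)
coord-sidePt q i j d m k {u} u∈ = ℤP.*-cancelˡ-≡ (+ scale q) _ _ {{nonZero-scale q}} (begin
  + scale q ℤ.* coord q i u
    ≡⟨ scale-coord-halfPt q i (sideVec q j d m) k u∈ ⟩
  sθ q i · sideVec q j d m
    ≡⟨ ·-bilinear (sθ q i) (sθ q j) (sθ q (next j)) (+ d) m ⟩
  + d ℤ.* (sθ q i · sθ q j) ℤ.+ m ℤ.* (sθ q i · sθ q (next j))
    ≡⟨ cong₂ (λ c c′ → + d ℤ.* c ℤ.+ m ℤ.* c′) (sθ·sθ q i j) (sθ·sθ q i (next j)) ⟩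
  + d ℤ.* (s ℤ.* cosθ i j) ℤ.+ m ℤ.* (s ℤ.* cosθ i (next j))
    ≡⟨ factor (+ d) m s (cosθ i j) (cosθ i (next j)) ⟩
  s ℤ.* (+ d ℤ.* cosθ i j ℤ.+ m ℤ.* cosθ i (next j)) ∎)
  where
  open ≡-Reasoning
  s = + scale q
  factor : ∀ d m s c c′ → d ℤ.* (s ℤ.* c) ℤ.+ m ℤ.* (s ℤ.* c′) ≡ s ℤ.* (d ℤ.* c ℤ.+ m ℤ.* c′)
  factor = solve-∀

i*1+j*0≡i : ∀ i j → i ℤ.* + 1 ℤ.+ j ℤ.* + 0 ≡ i
i*1+j*0≡i = solve-∀

coord-sidePt-self : ∀ q {h} i d m (k : Fin h) {u} → u ∈ sidePt q i d m k → coord q i u ≡ + d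
coord-sidePt-self q i d m k {u} u∈ = begin
  coord q i u                                      ≡⟨ coord-sidePt q i i d m k u∈ ⟩
  + d ℤ.* cosθ i i ℤ.+ m ℤ.* cosθ i (next i)
    ≡⟨ cong₂ (λ c c′ → + d ℤ.* c ℤ.+ m ℤ.* c′) (cosθ-self i) (cosθ-next i) ⟩
  + d ℤ.* + 1 ℤ.+ m ℤ.* + 0                        ≡⟨ i*1+j*0≡i (+ d) m ⟩
  + d                                              ∎
  where open ≡-Reasoning

side-self-≤ : ∀ d m → + d ℤ.* + 1 ℤ.+ m ℤ.* + 0 ℤ.≤ + d
side-self-≤ d m = ℤP.≤-reflexive (i*1+j*0≡i (+ d) m)

side-next-≤ : ∀ d {a m} → ℤ.- + a ℤ.≤ m → + d ℤ.* + 0 ℤ.+ m ℤ.* -1ℤ ℤ.≤ + a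
side-next-≤ d {a} {m} lo = ℤP.≤-trans (ℤP.≤-reflexive (simplify (+ d) m))
  (ℤP.≤-trans (ℤP.neg-mono-≤ lo) (ℤP.≤-reflexive (ℤP.neg-involutive (+ a))))
  where
  simplify : ∀ d m → d ℤ.* + 0 ℤ.+ m ℤ.* -1ℤ ≡ ℤ.- m
  simplify = solve-∀

side-opposite-≤ : ∀ d r m → + d ℤ.* -1ℤ ℤ.+ m ℤ.* + 0 ℤ.≤ + r
side-opposite-≤ d r m = ℤP.≤-trans (ℤP.≤-reflexive (simplify (+ d) m)) ℤP.neg-≤-pos
  where
  simplify : ∀ d m → d ℤ.* -1ℤ ℤ.+ m ℤ.* + 0 ≡ ℤ.- d
  simplify = solve-∀

side-prev-≤ : ∀ d {b m} → m ℤ.< + b → + d ℤ.* + 0 ℤ.+ m ℤ.* + 1 ℤ.≤ + b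
side-prev-≤ d {b} {m} hi = ℤP.≤-trans (ℤP.≤-reflexive (simplify (+ d) m)) (ℤP.<⇒≤ hi)
  where
  simplify : ∀ d m → d ℤ.* + 0 ℤ.+ m ℤ.* + 1 ≡ m
  simplify = solve-∀

coord-side-≤ : ∀ (r : Fin 4 → ℕ) i j m → ℤ.- + r (prev j) ℤ.≤ m → m ℤ.< + r (next j) →
  + r j ℤ.* cosθ i j ℤ.+ m ℤ.* cosθ i (next j) ℤ.≤ + r i
coord-side-≤ r 0F 0F m lo hi = side-self-≤ (r 0F) m
coord-side-≤ r 0F 1F m lo hi = side-next-≤ (r 1F) lo
coord-side-≤ r 0F 2F m lo hi = side-opposite-≤ (r 2F) (r 0F) m
coord-side-≤ r 0F 3F m lo hi = side-prev-≤ (r 3F) hi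
coord-side-≤ r 1F 0F m lo hi = side-prev-≤ (r 0F) hi
coord-side-≤ r 1F 1F m lo hi = side-self-≤ (r 1F) m
coord-side-≤ r 1F 2F m lo hi = side-next-≤ (r 2F) lo
coord-side-≤ r 1F 3F m lo hi = side-opposite-≤ (r 3F) (r 1F) m
coord-side-≤ r 2F 0F m lo hi = side-opposite-≤ (r 0F) (r 2F) m
coord-side-≤ r 2F 1F m lo hi = side-prev-≤ (r 1F) hi
coord-side-≤ r 2F 2F m lo hi = side-self-≤ (r 2F) m
coord-side-≤ r 2F 3F m lo hi = side-next-≤ (r 3F) lo
coord-side-≤ r 3F 0F m lo hi = side-next-≤ (r 0F) lo
coord-side-≤ r 3F 1F m lo hi = side-opposite-≤ (r 1F) (r 3F) m
coord-side-≤ r 3F 2F m lo hi = side-prev-≤ (r 2F) hi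
coord-side-≤ r 3F 3F m lo hi = side-self-≤ (r 3F) m

coord-levelPts-≤ : ∀ q {h} (r : Fin 4 → ℕ) i j (k : Fin h) {u} →
  u ∈ levelPts q j (r j) (r (prev j)) (r (next j)) k → coord q i u ℤ.≤ + r i
coord-levelPts-≤ q r i j k u∈
  with m , m∈ , u∈side ←
         find (∈-concatMap⁻ _ (subst (_ ∈_) (levelPts-window q j (r j) (r (prev j)) (r (next j)) k) u∈))
  with lo , hi ← window-bounds m∈ =
  ℤP.≤-trans (ℤP.≤-reflexive (coord-sidePt q i j (r j) m k u∈side)) (coord-side-≤ r i j m lo hi)

Adjacent : ∀ {h} → Fin h → Fin h → Set
Adjacent k ℓ = toℕ k ≡ suc (toℕ ℓ) ⊎ toℕ ℓ ≡ suc (toℕ k)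

adjacent⇒vadj : ∀ {h} {k ℓ : Fin h} → Adjacent k ℓ → T (vadj ℓ k)
adjacent⇒vadj (inj₁ k≡1+ℓ) = Equivalence.from T-∨ (inj₁ (ℕP.≡⇒≡ᵇ _ _ (sym k≡1+ℓ)))
adjacent⇒vadj (inj₂ ℓ≡1+k) = Equivalence.from T-∨ (inj₂ (ℕP.≡⇒≡ᵇ _ _ (sym ℓ≡1+k)))

vadj⇒∈-nbrs : ∀ q {h} {k ℓ : Fin h} x y → T (vadj ℓ k) → (x , y , k) ∈ nbrs q (x , y , ℓ)
vadj⇒∈-nbrs q {h} {k} x y ℓ~k =
  ∈-++⁺ʳ _ (∈-map⁺ (λ k′ → (x , y , k′)) (∈-filter⁺ (T? ∘ vadj _) (∈-allFin k) ℓ~k))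

Lipschitz-adjacent : ∀ {h} {x : Fin h → ℕ} {k ℓ} → Lipschitz x → Adjacent k ℓ → x k ≤ suc (x ℓ)
Lipschitz-adjacent lip (inj₁ k≡1+ℓ) = proj₁ (lip _ _ (sym k≡1+ℓ))
Lipschitz-adjacent lip (inj₂ ℓ≡1+k) = proj₂ (lip _ _ (sym ℓ≡1+k))

module Burning (q : Q) {h : ℕ} (B0 : List (Pt h)) (F : ℕ → List (Pt h)) (ρ : ℕ → Fin 4 → Fin h → ℕ) where
  open Run q h B0 F ρ

  count-L : ∀ P t i k → count P (L t i k)
    ≡ sum (map (λ m → count P (sidePt q i (ρ t i k) m k)) (window (ρ t (prev i) k) (ρ t (next i) k)))
  count-L P t i k = trans
    (cong (count P) (levelPts-window q i (ρ t i k) (ρ t (prev i) k) (ρ t (next i) k) k))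
    (count-concatMap P (λ m → sidePt q i (ρ t i k) m k) (window (ρ t (prev i) k) (ρ t (next i) k)))

  coord-L-≤ : ∀ {t} i j {ℓ v} → v ∈ L t j ℓ → coord q i v ℤ.≤ + ρ t i ℓ
  coord-L-≤ {t} i j {ℓ} = coord-levelPts-≤ q (λ j → ρ t j ℓ) i j ℓ

  burning-neighbour : ∀ {s u v} → T (B s u) → u ∈ nbrs q v →
    T (B (suc s) v) ⊎ (T (v ∈ᵇ F (suc s)) × T (not (B (suc s) v)))
  burning-neighbour {s} {u} {v} Bu u∈ =
    T-∨-∧-not (B s v) (any (B s) (nbrs q v)) (v ∈ᵇ F (suc s)) (any⁺ (B s) (Any.map (λ { refl → Bu }) u∈))

  inΔF⇒∈L : ∀ {s j ℓ v} → T (inΔF s j ℓ v) → v ∈ L (suc s) j ℓ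
  inΔF⇒∈L {s} {j} {ℓ} {v} Δ =
    ∈ᵇ⇒∈ (proj₁ (Equivalence.to (T-∧ {v ∈ᵇ L (suc s) j ℓ})
                  (proj₂ (Equivalence.to (T-∧ {v ∈ᵇ F (suc s)}) Δ))))

  inΔF⁺ : ∀ {s i ℓ v} → T (v ∈ᵇ F (suc s)) → v ∈ L (suc s) i ℓ → T (not (B (suc s) v)) →
    T (not (inFk s ℓ v)) → T (inΔF s i ℓ v)
  inΔF⁺ inF v∈L unburnt uncounted = Equivalence.from T-∧
    (inF , Equivalence.from T-∧ (∈⇒∈ᵇ v∈L , Equivalence.from T-∧ (unburnt , uncounted)))

module Fronts {q : Q} {h : ℕ} {B0 : List (Pt h)} {F : ℕ → List (Pt h)} {ρ : ℕ → Fin 4 → Fin h → ℕ}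
  {α : ℕ → Fin 4 → Fin h → ℕ} (fronts : Run.IsFronts q h B0 F ρ α) where
  open Run q h B0 F ρ
  open IsFronts fronts
  open Burning q B0 F ρ

  ρ-Lipschitz : ∀ t i → Lipschitz (ρ t i)
  ρ-Lipschitz zero    i = init-lip i
  ρ-Lipschitz (suc t) i = proj₁ (step t i)

  ρ-step-≤ : ∀ t i k → ρ t i k ≤ ρ (suc t) i k
  ρ-step-≤ t i k = ℕP.≤-trans (ℕP.m≤m+n _ _) (proj₁ (proj₂ (step t i)) k)

  ρ-adjacent-≤ : ∀ {t j k ℓ} → Adjacent k ℓ → ρ t j k ≤ suc (ρ (suc t) j ℓ)
  ρ-adjacent-≤ {t} {j} {k} {ℓ} adj =
    ℕP.≤-trans (Lipschitz-adjacent (ρ-Lipschitz t j) adj) (s≤s (ρ-step-≤ t j ℓ))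

  coord-inFi-≤ : ∀ s {i j ℓ v} → T (inFi s j ℓ v) → coord q i v ℤ.≤ + ρ s i ℓ
  coord-inFi-≤ (suc s) {i} {j} {ℓ} {v} inF with Equivalence.to T-∨ inF
  ... | inj₁ old = ℤP.≤-trans (coord-inFi-≤ s old) (ℤ.+≤+ (ρ-step-≤ s i ℓ))
  ... | inj₂ new = coord-L-≤ i j (inΔF⇒∈L new)

  coord-inFk-≤ : ∀ {s i ℓ v} → T (inFk s ℓ v) → coord q i v ℤ.≤ + ρ s i ℓ
  coord-inFk-≤ {s} {i} {ℓ} {v} inF
    with j , inFj ← satisfied (any⁻ (λ j → inFi s j ℓ v) (allFin 4) inF) = coord-inFi-≤ s inFj

  -- v is not yet in F^ℓ(s), since everything counted so far lies within the fronts at time s.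
  burning-beyond-front : ∀ {s i ℓ u v} → T (B s u) → u ∈ nbrs q v → v ∈ L (suc s) i ℓ →
    + ρ s i ℓ ℤ.< coord q i v → T (B (suc s) v) ⊎ T (inΔF s i ℓ v)
  burning-beyond-front Bu u∈ v∈L beyond with burning-neighbour Bu u∈
  ... | inj₁ burns            = inj₁ burns
  ... | inj₂ (inF , unburnt) =
    inj₂ (inΔF⁺ inF v∈L unburnt (T-not⁺ (λ inFk → ℤP.<⇒≱ beyond (coord-inFk-≤ inFk))))

  burning-side-≤ : ∀ {s i k ℓ m} → Adjacent k ℓ → ρ (suc s) i ℓ ≡ suc (ρ s i ℓ) →
    m ∈ window (ρ (suc s) (prev i) ℓ) (ρ (suc s) (next i) ℓ) →
    count (B s) (sidePt q i (ρ (suc s) i ℓ) m k)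
      ≤ count (B (suc s)) (sidePt q i (ρ (suc s) i ℓ) m ℓ)
        + count (inΔF s i ℓ) (sidePt q i (ρ (suc s) i ℓ) m ℓ)
  burning-side-≤ {s} {i} {k} {ℓ} {m} adj grow m∈ with halfPt-shape q (sideVec q i (ρ (suc s) i ℓ) m)
  ... | inj₁ empty = subst (λ side → count (B s) side ≤ _) (sym (empty k)) z≤n
  ... | inj₂ (x , y , single) =
    subst₂ (λ side-k side-ℓ → count (B s) side-k ≤ count (B (suc s)) side-ℓ + count (inΔF s i ℓ) side-ℓ)
      (sym (single k)) (sym (single ℓ))
      (count-singleton-≤ {P = B s} {B (suc s)} {inΔF s i ℓ}
        (λ Bu → burning-beyond-front Bu (vadj⇒∈-nbrs q x y (adjacent⇒vadj adj)) v∈L beyond))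
    where
    d = ρ (suc s) i ℓ
    v∈side : (x , y , ℓ) ∈ sidePt q i d m ℓ
    v∈side = subst ((x , y , ℓ) ∈_) (sym (single ℓ)) (here refl)
    v∈L : (x , y , ℓ) ∈ L (suc s) i ℓ
    v∈L = subst ((x , y , ℓ) ∈_)
            (sym (levelPts-window q i d (ρ (suc s) (prev i) ℓ) (ρ (suc s) (next i) ℓ) ℓ))
            (∈-concatMap⁺ (λ m → sidePt q i d m ℓ) (lose m∈ v∈side))
    beyond : + ρ s i ℓ ℤ.< coord q i (x , y , ℓ)
    beyond = subst (+ ρ s i ℓ ℤ.<_) (sym (trans (coord-sidePt-self q i d m ℓ v∈side) (cong +_ grow)))
               (ℤ.+<+ (ℕP.n<1+n _))

proposition3p7 : (q : Q) (h : ℕ) (B0 : List (Pt h)) (F : ℕ → List (Pt h))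
    (ρ : ℕ → Fin 4 → Fin h → ℕ) (α : ℕ → Fin 4 → Fin h → ℕ) →
    NonDecreasing F → Run.IsFronts q h B0 F ρ α →
    (i : Fin 4) (s : ℕ) (k ℓ : Fin h) →
    (toℕ k ≡ suc (toℕ ℓ) ⊎ toℕ ℓ ≡ suc (toℕ k)) →
    ρ (suc s) i ℓ ≡ suc (ρ s i ℓ) →
    ρ s i k ≡ suc (ρ s i ℓ) →
    Run.φ q h B0 F ρ s i k ≤ Run.φ q h B0 F ρ (suc s) i ℓ + Run.Δf q h B0 F ρ s i ℓ + 2
proposition3p7 q h B0 F ρ α _ fronts i s k ℓ adj grow jump = begin
  φ s i k
    ≡⟨ count-L (B s) s i k ⟩
  sum (map (λ m → count (B s) (sidePt q i (ρ s i k) m k)) (window a b))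
    ≡⟨ cong (λ d → sum (map (λ m → count (B s) (sidePt q i d m k)) (window a b))) (trans jump (sym grow)) ⟩
  sum (map burning (window a b))
    ≤⟨ sum-window-≤ burning counted (λ m → count-halfPt-≤1 (B s) q _ k) (burning-side-≤ adj grow)
                    (ρ-adjacent-≤ adj) (ρ-adjacent-≤ adj) ⟩
  sum (map counted (window a′ b′)) + 2
    ≡⟨ cong (ℕ._+ 2) (sum-map-+ burnt protected (window a′ b′)) ⟩
  sum (map burnt (window a′ b′)) + sum (map protected (window a′ b′)) + 2
    ≡⟨ cong₂ (λ x y → x + y + 2) (count-L (B (suc s)) (suc s) i ℓ) (count-L (inΔF s i ℓ) (suc s) i ℓ) ⟨
  φ (suc s) i ℓ + Δf s i ℓ + 2
    ∎
  where
  open Run q h B0 F ρ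
  open Burning q B0 F ρ
  open Fronts fronts
  open ℕP.≤-Reasoning
  a = ρ s (prev i) k
  b = ρ s (next i) k
  a′ = ρ (suc s) (prev i) ℓ
  b′ = ρ (suc s) (next i) ℓ
  burning burnt protected counted : ℤ → ℕ
  burning m = count (B s) (sidePt q i (ρ (suc s) i ℓ) m k)
  burnt m = count (B (suc s)) (sidePt q i (ρ (suc s) i ℓ) m ℓ)
  protected m = count (inΔF s i ℓ) (sidePt q i (ρ (suc s) i ℓ) m ℓ)
  counted m = burnt m + protected m
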